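{- Let $G$ be a finite simple graph and $v$ a cut-vertex of $G$. Let $D_1,\dots,D_l$ be the connected components of $G-v$, and for $j=1,\dots,l$ let $C_j$ be the subgraph of $G$ induced by $V(D_j)\cup\{v\}$ (so each $C_j$ contains its own copy of $v$). Then \[ J(G)=\frac{1}{x^{l-1}}\prod_{j=1}^{l}J(C_j\mid v\in W)+y\prod_{j=1}^{l}J(C_j-v)+(1-y)\prod_{j=1}^{l}J\bigl(C_j\mid N_{C_j}[v]\cap W=\emptyset\bigr). \]
   Context: For a finite simple graph $H$ and $W\subseteq V(H)$, $N_H[W]$ is the set of vertices that are in $W$ or adjacent to a vertex of $W$, and $N_H(W):=N_H[W]\setminus W$; for a vertex $a$, $N_H[a]$ is $a$ together with its neighbours in $H$. The bivariate domination polynomial is $J(H;x,y)=J(H):=\sum_{W\subseteq V(H)} x^{|W|}y^{|N_H(W)|}$. For a condition $c(W)$ on subsets $W\subseteq V(H)$, $J(H\mid c(W))$ is the same sum taken only over those $W\subseteq V(H)$ satisfying $c(W)$. $H-v$ is obtained by deleting $v$. A cut-vertex is a vertex whose deletion increases the number of connected components. -}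

module Defs where

open import Data.Bool using (Bool; true; false; _∧_; _∨_; not; if_then_else_)
open import Data.Nat as ℕ using (ℕ; zero; suc)
open import Data.Fin using (Fin; zero; suc)
open import Data.Fin.Subset using (Subset; inside; outside; ∣_∣)
open import Data.Vec using (Vec; []; _∷_; lookup; tabulate)
open import Data.List using (List; []; _∷_; _++_; map)
open import Data.Integer using (ℤ; _+_; _*_; _^_; +_)
open import Data.Product using (Σ; ∃; _×_; _,_)
open import Function.Bundles using (_⇔_)
open import Relation.Binary.PropositionalEquality using (_≡_)
open import Relation.Nullary.Decidable using (⌊_⌋)
import Data.Fin
import Data.Fin.Subset

record Graph (n : ℕ) : Set where
  field
    adj    : Fin n → Fin n → Bool
    sym    : ∀ u w → adj u w ≡ adj w u
    irrefl : ∀ u → adj u u ≡ false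
open Graph public

anyFin : ∀ {n} → (Fin n → Bool) → Bool
anyFin {zero}  p = false
anyFin {suc n} p = p zero ∨ anyFin (λ i → p (suc i))

allFin : ∀ {n} → (Fin n → Bool) → Bool
allFin {zero}  p = true
allFin {suc n} p = p zero ∧ allFin (λ i → p (suc i))

allSubsets : ∀ n → List (Subset n)
allSubsets zero    = [] ∷ []
allSubsets (suc n) = map (outside ∷_) (allSubsets n) ++ map (inside ∷_) (allSubsets n)

sumℤ : ∀ {A : Set} → (A → ℤ) → List A → ℤ
sumℤ f []       = + 0
sumℤ f (a ∷ as) = f a + sumℤ f as

prodFin : ∀ {l} → (Fin l → ℤ) → ℤ
prodFin {zero}  f = + 1
prodFin {suc l} f = f zero * prodFin (λ j → f (suc j))

sub : ∀ {n} → (Fin n → Bool) → Subset n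
sub = tabulate

_⊆ᵇ_ : ∀ {n} → Subset n → Subset n → Bool
W ⊆ᵇ S = allFin (λ u → not (lookup W u) ∨ lookup S u)

disjointᵇ : ∀ {n} → Subset n → Subset n → Bool
disjointᵇ A W = allFin (λ u → not (lookup A u ∧ lookup W u))

-- Induced subgraphs of G are represented by their vertex set S ⊆ V(G).
-- Open neighbourhood N_H(W) = N_H[W] ∖ W in the induced subgraph H = G[S].
openNbhd : ∀ {n} → Graph n → Subset n → Subset n → Subset n
openNbhd G S W = sub (λ u → lookup S u ∧ not (lookup W u)
                            ∧ anyFin (λ w → lookup W w ∧ adj G w u))

closedNbhd : ∀ {n} → Graph n → Subset n → Fin n → Subset n
closedNbhd G S a = sub (λ u → lookup S u ∧ (lookup (Data.Fin.Subset.⁅ a ⁆) u ∨ adj G a u))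

-- Bivariate domination polynomial of H = G[S], evaluated at (x , y),
-- restricted to subsets W ⊆ S satisfying the (Boolean) condition c.
-- J(H ∣ c(W)) = Σ_{W ⊆ V(H), c(W)} x^|W| y^|N_H(W)|
Jc : ∀ {n} → Graph n → Subset n → (Subset n → Bool) → ℤ → ℤ → ℤ
Jc G S c x y = sumℤ term (allSubsets _)
  where
  term : Subset _ → ℤ
  term W = if (W ⊆ᵇ S) ∧ c W then x ^ ∣ W ∣ * y ^ ∣ openNbhd G S W ∣ else + 0

J : ∀ {n} → Graph n → Subset n → ℤ → ℤ → ℤ
J G S = Jc G S (λ _ → true)

data Reach {n} (G : Graph n) (S : Subset n) : Fin n → Fin n → Set where
  here : ∀ {u} → lookup S u ≡ true → Reach G S u u
  step : ∀ {u w z} → lookup S u ≡ true → adj G u w ≡ true → Reach G S w z → Reach G S u z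

-- c : Fin n → Fin k labels the connected components of G[S] bijectively
-- (values of c outside S are irrelevant).
IsComponentLabelling : ∀ {n} → Graph n → Subset n → (k : ℕ) → (Fin n → Fin k) → Set
IsComponentLabelling G S k c =
  (∀ j → ∃ λ u → lookup S u ≡ true × c u ≡ j) ×
  (∀ u w → lookup S u ≡ true → lookup S w ≡ true → (c u ≡ c w) ⇔ Reach G S u w)

NumComponents : ∀ {n} → Graph n → Subset n → ℕ → Set
NumComponents G S k = ∃ λ c → IsComponentLabelling G S k c

minus : ∀ {n} → Subset n → Fin n → Subset n
minus S v = sub (λ u → lookup S u ∧ not (lookup (Data.Fin.Subset.⁅ v ⁆) u))

IsCutVertex : ∀ {n} → Graph n → Fin n → Set
IsCutVertex G v = ∀ k l → NumComponents G Data.Fin.Subset.⊤ k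
                        → NumComponents G (minus Data.Fin.Subset.⊤ v) l → k ℕ.< l

Dset : ∀ {n l} → Graph n → Fin n → (Fin n → Fin l) → Fin l → Subset n
Dset G v c j = sub (λ u → lookup (minus Data.Fin.Subset.⊤ v) u ∧ ⌊ c u Data.Fin.≟ j ⌋)

Cset : ∀ {n l} → Graph n → Fin n → (Fin n → Fin l) → Fin l → Subset n
Cset G v c j = sub (λ u → lookup (Dset G v c j) u ∨ lookup (Data.Fin.Subset.⁅ v ⁆) u)

module Submission where

-- Split J(G) = Σ_W x^|W| y^|N(W)| according to whether v ∈ W. Each monomial is a
-- product of local weights, one per vertex (Weights.term-as-product). A vertex
-- u ≠ v only sees its own component, so the weights of W factor over the pieces
-- W_j = W ∩ V(D_j), and only the factors at v need comparing (CutVertex.glue):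
--   v ∉ W:   x^(l-1) x^|W+v| y^|N(W+v)| = ∏ⱼ x^|W_j+v| y^|N_{C_j}(W_j+v)|,
--   v ∉ W:   x^|W| y^|N(W)| = y^[v ∈ N(W)] ∏ⱼ x^|W_j| y^|N_{D_j}(W_j)|,
-- and y^[v ∈ N(W)] = y + (1 - y)[W ∩ N[v] = ∅]. Finally a sum over W ⊆ T of a
-- product of functions of the pieces of W is the product of the sums over the
-- pieces (sumWithin-factorise), which yields the three products of the theorem.

open import Defs hiding (sym)
open import Data.Bool using (Bool; true; false; _∧_; _∨_; not; if_then_else_)
open import Data.Nat using (ℕ; zero; suc; _∸_)
open import Data.Fin using (Fin; zero; suc; _≟_; punchIn)
open import Data.Fin.Properties using (punchInᵢ≢i)
open import Data.Fin.Subset using (Subset; inside; outside; ∣_∣; ⊤; ⁅_⁆)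
open import Data.Fin.Subset.Properties using (∈⊤; x∈⁅x⁆; x≢y⇒x∉⁅y⁆)
open import Data.Vec using ([]; _∷_; lookup; tabulate; _[_]≔_)
open import Data.Vec.Properties using (lookup∘tabulate; tabulate-cong; lookup∘update; lookup∘update′; []=⇒lookup; lookup⇒[]=)
open import Data.List using ([]; _∷_; _++_; map)
open import Data.Integer using (ℤ; _+_; _*_; _-_; _^_; +_)
open import Data.Integer.Properties as ℤP using (*-1-commutativeMonoid)
open import Data.Integer.Tactic.RingSolver using (solve-∀)
open import Function using (_∘_)
open import Function.Bundles using (Equivalence)
open import Data.Product using (proj₂)
open import Relation.Binary.PropositionalEquality hiding (J)
open import Relation.Nullary.Decidable using (does; yes; no; dec-true; dec-false; isYes≗does)
open import Relation.Nullary.Negation using (contradiction)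
open import Data.Bool.Properties using (∧-assoc; ∧-comm; ∨-zeroʳ; ∧-zeroʳ; ∨-identityʳ; ∧-identityʳ; not-injective)

open import Algebra.Properties.CommutativeMonoid.Sum *-1-commutativeMonoid
  using (sum-remove; sum-cong-≗; ∑-distrib-+; ∑-comm)
  renaming (sum to ∏)

-- Boolean equality of vertices; unlike ⌊ u ≟ v ⌋ it reduces under suc.
_==_ : ∀ {n} → Fin n → Fin n → Bool
u == v = does (u ≟ v)

==-refl : ∀ {n} (u : Fin n) → (u == u) ≡ true
==-refl u = dec-true (u ≟ u) refl

==-≢ : ∀ {n} {u v : Fin n} → u ≢ v → (u == v) ≡ false
==-≢ {u = u} {v} = dec-false (u ≟ v)

∧-trueˡ : ∀ {a b} → a ∧ b ≡ true → a ≡ true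
∧-trueˡ {true} _ = refl

∧-trueʳ : ∀ {a b} → a ∧ b ≡ true → b ≡ true
∧-trueʳ {true} e = e

allFin-cong : ∀ {n} {p q : Fin n → Bool} → (∀ u → p u ≡ q u) → allFin p ≡ allFin q
allFin-cong {zero}  h = refl
allFin-cong {suc n} h = cong₂ _∧_ (h zero) (allFin-cong (h ∘ suc))

anyFin-cong : ∀ {n} {p q : Fin n → Bool} → (∀ u → p u ≡ q u) → anyFin p ≡ anyFin q
anyFin-cong {zero}  h = refl
anyFin-cong {suc n} h = cong₂ _∨_ (h zero) (anyFin-cong (h ∘ suc))

allFin-true : ∀ {n} (p : Fin n → Bool) → (∀ u → p u ≡ true) → allFin p ≡ true
allFin-true {zero}  p h = refl
allFin-true {suc n} p h = cong₂ _∧_ (h zero) (allFin-true (p ∘ suc) (h ∘ suc))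

allFin-elim : ∀ {n} (p : Fin n → Bool) → allFin p ≡ true → ∀ u → p u ≡ true
allFin-elim p e zero    = ∧-trueˡ e
allFin-elim p e (suc u) = allFin-elim (p ∘ suc) (∧-trueʳ {p zero} e) u

anyFin-false : ∀ {n} (p : Fin n → Bool) → (∀ u → p u ≡ false) → anyFin p ≡ false
anyFin-false {zero}  p h = refl
anyFin-false {suc n} p h = cong₂ _∨_ (h zero) (anyFin-false (p ∘ suc) (h ∘ suc))

allFin-∧ : ∀ {n} (p q : Fin n → Bool) → allFin p ∧ allFin q ≡ allFin (λ u → p u ∧ q u)
allFin-∧ {zero}  p q = refl
allFin-∧ {suc n} p q =
  trans (interchange (p zero) (q zero) _ _) (cong (_∧_ (p zero ∧ q zero)) (allFin-∧ (p ∘ suc) (q ∘ suc)))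
  where interchange : ∀ a b c d → (a ∧ c) ∧ (b ∧ d) ≡ (a ∧ b) ∧ (c ∧ d)
        interchange false b c d = refl
        interchange true  b c d = trans (sym (∧-assoc c b d)) (trans (cong (_∧ d) (∧-comm c b)) (∧-assoc b c d))

allFin-not : ∀ {n} (p : Fin n → Bool) → allFin (λ u → not (p u)) ≡ not (anyFin p)
allFin-not {zero}  p = refl
allFin-not {suc n} p = trans (cong (_∧_ (not (p zero))) (allFin-not (p ∘ suc))) (deMorgan (p zero) _)
  where deMorgan : ∀ a b → not a ∧ not b ≡ not (a ∨ b)
        deMorgan true  b = refl
        deMorgan false b = refl

prodFin≡∏ : ∀ {l} (f : Fin l → ℤ) → prodFin f ≡ ∏ f
prodFin≡∏ {zero}  f = refl
prodFin≡∏ {suc l} f = cong (f zero *_) (prodFin≡∏ (f ∘ suc))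

∏-const : ∀ {m} (z : ℤ) (f : Fin m → ℤ) → (∀ j → f j ≡ z) → ∏ f ≡ z ^ m
∏-const {zero}  z f h = refl
∏-const {suc m} z f h = cong₂ _*_ (h zero) (∏-const z (f ∘ suc) (h ∘ suc))

∏-single : ∀ {m} (k : Fin m) (f : Fin m → ℤ) → (∀ j → j ≢ k → f j ≡ + 1) → ∏ f ≡ f k
∏-single {suc m} k f h = begin
  ∏ f                          ≡⟨ sum-remove {i = k} f ⟩
  f k * ∏ (f ∘ punchIn k)      ≡⟨ cong (f k *_) (∏-const (+ 1) _ (λ j → h _ (punchInᵢ≢i k j))) ⟩
  f k * (+ 1) ^ m              ≡⟨ cong (f k *_) (ℤP.^-zeroˡ m) ⟩
  f k * + 1                    ≡⟨ ℤP.*-identityʳ (f k) ⟩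
  f k                          ∎
  where open ≡-Reasoning

∏-agree-off : ∀ {n} (v : Fin n) (a b : Fin n → ℤ) → (∀ u → u ≢ v → a u ≡ b u) →
  ∀ k m → k * a v ≡ m * b v → k * ∏ a ≡ m * ∏ b
∏-agree-off {suc n} v a b agree k m atV = begin
  k * ∏ a                         ≡⟨ cong (k *_) (sum-remove {i = v} a) ⟩
  k * (a v * ∏ (a ∘ punchIn v))   ≡⟨ sym (ℤP.*-assoc k (a v) _) ⟩
  k * a v * ∏ (a ∘ punchIn v)     ≡⟨ cong₂ _*_ atV (sum-cong-≗ (λ j → agree _ (punchInᵢ≢i v j))) ⟩
  m * b v * ∏ (b ∘ punchIn v)     ≡⟨ ℤP.*-assoc m (b v) _ ⟩
  m * (b v * ∏ (b ∘ punchIn v))   ≡⟨ cong (m *_) (sym (sum-remove {i = v} b)) ⟩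
  m * ∏ b                         ∎
  where open ≡-Reasoning

∏-perturb : ∀ {l} (k : Fin l) (a b : Fin l → ℤ) →
  ∏ (λ j → a j + (if k == j then b j else + 0))
    ≡ ∏ a + ∏ (λ j → if k == j then b j else a j)
∏-perturb zero a b =
  trans (cong (λ r → (a zero + b zero) * r) (sum-cong-≗ (λ j → ℤP.+-identityʳ (a (suc j)))))
        (ℤP.*-distribʳ-+ _ (a zero) (b zero))
∏-perturb (suc k) a b =
  trans (cong₂ _*_ (ℤP.+-identityʳ (a zero)) (∏-perturb k (a ∘ suc) (b ∘ suc)))
        (ℤP.*-distribˡ-+ (a zero) _ _)

sumℤ-cong : ∀ {A : Set} {f g : A → ℤ} → (∀ a → f a ≡ g a) → ∀ as → sumℤ f as ≡ sumℤ g as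
sumℤ-cong h []       = refl
sumℤ-cong h (a ∷ as) = cong₂ _+_ (h a) (sumℤ-cong h as)

sumℤ-++ : ∀ {A : Set} (f : A → ℤ) as bs → sumℤ f (as ++ bs) ≡ sumℤ f as + sumℤ f bs
sumℤ-++ f []       bs = sym (ℤP.+-identityˡ _)
sumℤ-++ f (a ∷ as) bs = trans (cong (_+_ (f a)) (sumℤ-++ f as bs)) (sym (ℤP.+-assoc (f a) _ _))

sumℤ-map : ∀ {A B : Set} (f : B → ℤ) (g : A → B) as → sumℤ f (map g as) ≡ sumℤ (f ∘ g) as
sumℤ-map f g []       = refl
sumℤ-map f g (a ∷ as) = cong (_+_ (f (g a))) (sumℤ-map f g as)

sumℤ-+ : ∀ {A : Set} (f g : A → ℤ) as → sumℤ (λ a → f a + g a) as ≡ sumℤ f as + sumℤ g as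
sumℤ-+ f g []       = refl
sumℤ-+ f g (a ∷ as) = trans (cong (_+_ (f a + g a)) (sumℤ-+ f g as)) (swap (f a) (g a) _ _)
  where swap : ∀ a b c d → (a + b) + (c + d) ≡ (a + c) + (b + d)
        swap = solve-∀

sumℤ-* : ∀ {A : Set} (k : ℤ) (f : A → ℤ) as → k * sumℤ f as ≡ sumℤ (λ a → k * f a) as
sumℤ-* k f []       = ℤP.*-zeroʳ k
sumℤ-* k f (a ∷ as) = trans (ℤP.*-distribˡ-+ k (f a) _) (cong (_+_ (k * f a)) (sumℤ-* k f as))

sumSubsets : ∀ {n} → (Subset n → ℤ) → ℤ
sumSubsets f = sumℤ f (allSubsets _)

sumSubsets-cong : ∀ {n} {f g : Subset n → ℤ} → (∀ W → f W ≡ g W) → sumSubsets f ≡ sumSubsets g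
sumSubsets-cong h = sumℤ-cong h (allSubsets _)

sumSubsets-suc : ∀ {n} (f : Subset (suc n) → ℤ) →
  sumSubsets f ≡ sumSubsets (f ∘ (outside ∷_)) + sumSubsets (f ∘ (inside ∷_))
sumSubsets-suc {n} f = begin
  sumℤ f (map (outside ∷_) (allSubsets n) ++ map (inside ∷_) (allSubsets n))
    ≡⟨ sumℤ-++ f (map (outside ∷_) (allSubsets n)) _ ⟩
  sumℤ f (map (outside ∷_) (allSubsets n)) + sumℤ f (map (inside ∷_) (allSubsets n))
    ≡⟨ cong₂ _+_ (sumℤ-map f (outside ∷_) (allSubsets n)) (sumℤ-map f (inside ∷_) (allSubsets n)) ⟩
  sumSubsets (f ∘ (outside ∷_)) + sumSubsets (f ∘ (inside ∷_))
    ∎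
  where open ≡-Reasoning

sumSubsets-zero : ∀ {n} → sumSubsets {n} (λ _ → + 0) ≡ + 0
sumSubsets-zero {n} =
  trans (sym (sumℤ-* (+ 0) (λ _ → + 0) (allSubsets n))) (ℤP.*-zeroˡ (sumSubsets {n} (λ _ → + 0)))

insertAt : ∀ {n} → Fin n → Subset n → Subset n
insertAt v W = W [ v ]≔ inside

sum-containing : ∀ {n} (v : Fin n) (f : Subset n → ℤ) →
  sumSubsets (λ W → if lookup W v then f W else + 0)
    ≡ sumSubsets (λ W → if lookup W v then + 0 else f (insertAt v W))
sum-containing {suc n} zero f = begin
  sumSubsets (λ W → if lookup W zero then f W else + 0)
    ≡⟨ sumSubsets-suc (λ W → if lookup W zero then f W else + 0) ⟩
  sumSubsets {n} (λ _ → + 0) + sumSubsets (f ∘ (inside ∷_))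
    ≡⟨ cong (_+ sumSubsets (f ∘ (inside ∷_))) (sumSubsets-zero {n}) ⟩
  + 0 + sumSubsets (f ∘ (inside ∷_))
    ≡⟨ ℤP.+-comm (+ 0) (sumSubsets (f ∘ (inside ∷_))) ⟩
  sumSubsets (f ∘ (inside ∷_)) + + 0
    ≡⟨ cong (_+_ (sumSubsets (f ∘ (inside ∷_)))) (sumSubsets-zero {n}) ⟨
  sumSubsets (f ∘ (inside ∷_)) + sumSubsets {n} (λ _ → + 0)
    ≡⟨ sumSubsets-suc (λ W → if lookup W zero then + 0 else f (insertAt zero W)) ⟨
  sumSubsets (λ W → if lookup W zero then + 0 else f (insertAt zero W))
    ∎
  where open ≡-Reasoning
sum-containing (suc v) f
  rewrite sumSubsets-suc (λ W → if lookup W (suc v) then f W else + 0)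
        | sumSubsets-suc (λ W → if lookup W (suc v) then + 0 else f (insertAt (suc v) W))
  = cong₂ _+_ (sum-containing v (f ∘ (outside ∷_))) (sum-containing v (f ∘ (inside ∷_)))

-- W ⊆ p for a vertex predicate p; note W ⊆ᵇ S is W ⊆ₚ lookup S.
_⊆ₚ_ : ∀ {n} → Subset n → (Fin n → Bool) → Bool
W ⊆ₚ p = allFin (λ u → not (lookup W u) ∨ p u)

⊆ₚ-cong : ∀ {n} (W : Subset n) {p q : Fin n → Bool} →
  (∀ u → lookup W u ≡ true → p u ≡ q u) → W ⊆ₚ p ≡ W ⊆ₚ q
⊆ₚ-cong W h = allFin-cong pointwise
  where
  pointwise : ∀ u → not (lookup W u) ∨ _ ≡ not (lookup W u) ∨ _
  pointwise u with lookup W u in member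
  ... | true  = h u member
  ... | false = refl

⊆ₚ-elim : ∀ {n} (W : Subset n) (p : Fin n → Bool) → W ⊆ₚ p ≡ true → ∀ u → lookup W u ≡ true → p u ≡ true
⊆ₚ-elim W p sub u member = subst (λ b → not b ∨ p u ≡ true) member (allFin-elim _ sub u)

⊆ₚ-reject : ∀ {n} (W : Subset n) (p : Fin n → Bool) u → lookup W u ≡ true → p u ≡ false → W ⊆ₚ p ≡ false
⊆ₚ-reject W p u member pu≡false with W ⊆ₚ p in sub
... | false = refl
... | true  = contradiction (trans (sym (⊆ₚ-elim W p sub u member)) pu≡false) λ ()

⊆ₚ-accept : ∀ {n} (W : Subset n) (p : Fin n → Bool) → (∀ u → lookup W u ≡ true → p u ≡ true) → W ⊆ₚ p ≡ true
⊆ₚ-accept W p h = trans (⊆ₚ-cong W h) (allFin-true _ (λ u → ∨-zeroʳ (not (lookup W u))))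

⊆ₚ-weaken : ∀ {n} (W : Subset n) {p q : Fin n → Bool} → (∀ u → p u ≡ true → q u ≡ true) →
  W ⊆ₚ p ≡ true → W ⊆ₚ q ≡ true
⊆ₚ-weaken W {p} {q} p⇒q sub = ⊆ₚ-accept W q (λ u u∈W → p⇒q u (⊆ₚ-elim W p sub u u∈W))

sumWithin : ∀ {n} → (Fin n → Bool) → (Subset n → ℤ) → ℤ
sumWithin p f = sumSubsets (λ W → if W ⊆ₚ p then f W else + 0)

sumWithin-suc : ∀ {n} (p : Fin (suc n) → Bool) (f : Subset (suc n) → ℤ) →
  sumWithin p f ≡ sumWithin (p ∘ suc) (f ∘ (outside ∷_))
                  + (if p zero then sumWithin (p ∘ suc) (f ∘ (inside ∷_)) else + 0)
sumWithin-suc {n} p f =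
  trans (sumSubsets-suc (λ W → if W ⊆ₚ p then f W else + 0))
        (cong (_+_ (sumWithin (p ∘ suc) (f ∘ (outside ∷_)))) withZero)
  where
  withZero : sumSubsets (λ W → if p zero ∧ (W ⊆ₚ (p ∘ suc)) then f (inside ∷ W) else + 0)
             ≡ (if p zero then sumWithin (p ∘ suc) (f ∘ (inside ∷_)) else + 0)
  withZero with p zero
  ... | true  = refl
  ... | false = sumSubsets-zero {n}

restrictTo : ∀ {n} → (Fin n → Bool) → Subset n → Subset n
restrictTo p W = tabulate (λ u → lookup W u ∧ p u)

sumWithin-factorise : ∀ {n l} (T : Fin n → Bool) (c : Fin n → Fin l) (F : Fin l → Subset n → ℤ) →
  sumWithin T (λ W → ∏ (λ j → F j (restrictTo (λ u → c u == j) W)))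
    ≡ ∏ (λ j → sumWithin (λ u → T u ∧ c u == j) (F j))
sumWithin-factorise {zero} T c F =
  trans (ℤP.+-identityʳ _) (sum-cong-≗ (λ j → sym (ℤP.+-identityʳ (F j []))))
sumWithin-factorise {suc n} {l} T c F = begin
  sumWithin T (λ W → ∏ (λ j → F j (restrictTo (λ u → c u == j) W)))
    ≡⟨ sumWithin-suc T _ ⟩
  sumWithin (T ∘ suc) (λ W → ∏ (λ j → F j (outside ∷ piece j W)))
    + (if T zero then sumWithin (T ∘ suc) (λ W → ∏ (λ j → F j ((c zero == j) ∷ piece j W))) else + 0)
    ≡⟨ cong₂ _+_ withoutZero (cong (λ s → if T zero then s else + 0) withZero) ⟩
  ∏ A + (if T zero then ∏ (λ j → if c zero == j then B j else A j) else + 0)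
    ≡⟨ combine (T zero) ⟩
  ∏ (λ j → A j + (if T zero ∧ c zero == j then B j else + 0))
    ≡⟨ sum-cong-≗ (λ j → sumWithin-suc (λ u → T u ∧ c u == j) (F j)) ⟨
  ∏ (λ j → sumWithin (λ u → T u ∧ c u == j) (F j))
    ∎
  where
  open ≡-Reasoning
  piece : Fin l → Subset n → Subset n
  piece j = restrictTo (λ u → c (suc u) == j)
  classes : Fin l → Fin n → Bool
  classes j u = T (suc u) ∧ c (suc u) == j
  A B : Fin l → ℤ
  A j = sumWithin (classes j) (F j ∘ (outside ∷_))
  B j = sumWithin (classes j) (F j ∘ (inside ∷_))
  withoutZero : sumWithin (T ∘ suc) (λ W → ∏ (λ j → F j (outside ∷ piece j W))) ≡ ∏ A
  withoutZero = sumWithin-factorise (T ∘ suc) (c ∘ suc) (λ j → F j ∘ (outside ∷_))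
  chooseB : ∀ j → sumWithin (classes j) (F j ∘ ((c zero == j) ∷_)) ≡ (if c zero == j then B j else A j)
  chooseB j with c zero == j
  ... | true  = refl
  ... | false = refl
  withZero : sumWithin (T ∘ suc) (λ W → ∏ (λ j → F j ((c zero == j) ∷ piece j W)))
             ≡ ∏ (λ j → if c zero == j then B j else A j)
  withZero = trans (sumWithin-factorise (T ∘ suc) (c ∘ suc) (λ j → F j ∘ ((c zero == j) ∷_))) (sum-cong-≗ chooseB)
  combine : ∀ t → ∏ A + (if t then ∏ (λ j → if c zero == j then B j else A j) else + 0)
                  ≡ ∏ (λ j → A j + (if t ∧ c zero == j then B j else + 0))
  combine true  = sym (∏-perturb (c zero) A B)
  combine false = trans (ℤP.+-identityʳ (∏ A)) (sum-cong-≗ (λ j → sym (ℤP.+-identityʳ (A j))))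

sumWithin-scale : ∀ {n} (p : Fin n → Bool) (k : ℤ) (f g : Subset n → ℤ) →
  (∀ W → W ⊆ₚ p ≡ true → k * f W ≡ g W) → k * sumWithin p f ≡ sumWithin p g
sumWithin-scale {n} p k f g h = trans (sumℤ-* k _ (allSubsets n)) (sumSubsets-cong pointwise)
  where
  pointwise : ∀ W → k * (if W ⊆ₚ p then f W else + 0) ≡ (if W ⊆ₚ p then g W else + 0)
  pointwise W with W ⊆ₚ p in sub
  ... | true  = h W sub
  ... | false = ℤP.*-zeroʳ k

avoiding : ∀ {n} → Fin n → Fin n → Bool
avoiding v u = not (u == v)

⊆ₚ-avoiding : ∀ {n} (v : Fin n) (W : Subset n) → W ⊆ₚ avoiding v ≡ not (lookup W v)
⊆ₚ-avoiding v W with lookup W v in v∈W?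
... | true  = ⊆ₚ-reject W (avoiding v) v v∈W? (cong not (==-refl v))
... | false = ⊆ₚ-accept W (avoiding v) otherVertex
  where
  otherVertex : ∀ u → lookup W u ≡ true → avoiding v u ≡ true
  otherVertex u u∈W with u ≟ v
  ... | yes refl = contradiction (trans (sym u∈W) v∈W?) λ ()
  ... | no _     = refl

avoiding⇒∉ : ∀ {n} (v : Fin n) (W : Subset n) → W ⊆ₚ avoiding v ≡ true → lookup W v ≡ false
avoiding⇒∉ v W sub = not-injective (trans (sym (⊆ₚ-avoiding v W)) sub)

sum-split-at : ∀ {n} (v : Fin n) (f : Subset n → ℤ) →
  sumSubsets f ≡ sumWithin (avoiding v) (f ∘ insertAt v) + sumWithin (avoiding v) f
sum-split-at {n} v f = begin
  sumSubsets f
    ≡⟨ sumSubsets-cong byMembership ⟩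
  sumSubsets (λ W → (if lookup W v then f W else + 0) + (if lookup W v then + 0 else f W))
    ≡⟨ sumℤ-+ (λ W → if lookup W v then f W else + 0) _ (allSubsets n) ⟩
  sumSubsets (λ W → if lookup W v then f W else + 0) + sumSubsets (λ W → if lookup W v then + 0 else f W)
    ≡⟨ cong (_+ sumSubsets (λ W → if lookup W v then + 0 else f W)) (sum-containing v f) ⟩
  sumSubsets (λ W → if lookup W v then + 0 else f (insertAt v W)) + sumSubsets (λ W → if lookup W v then + 0 else f W)
    ≡⟨ cong₂ _+_ (sumSubsets-cong (asAvoiding (f ∘ insertAt v))) (sumSubsets-cong (asAvoiding f)) ⟩
  sumWithin (avoiding v) (f ∘ insertAt v) + sumWithin (avoiding v) f
    ∎
  where
  open ≡-Reasoning
  byMembership : ∀ W → f W ≡ (if lookup W v then f W else + 0) + (if lookup W v then + 0 else f W)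
  byMembership W with lookup W v
  ... | true  = sym (ℤP.+-identityʳ (f W))
  ... | false = sym (ℤP.+-identityˡ (f W))
  asAvoiding : ∀ g W → (if lookup W v then + 0 else g W) ≡ (if W ⊆ₚ avoiding v then g W else + 0)
  asAvoiding g W rewrite ⊆ₚ-avoiding v W with lookup W v
  ... | true  = refl
  ... | false = refl

lookup-⊤ : ∀ {n} (u : Fin n) → lookup ⊤ u ≡ true
lookup-⊤ u = []=⇒lookup (∈⊤ {x = u})

lookup-⁅⁆ : ∀ {n} (v u : Fin n) → lookup ⁅ v ⁆ u ≡ (u == v)
lookup-⁅⁆ v u with u ≟ v
... | yes refl = []=⇒lookup (x∈⁅x⁆ u)
... | no u≢v with lookup ⁅ v ⁆ u in u∈⁅v⁆
...   | true  = contradiction (lookup⇒[]= u ⁅ v ⁆ u∈⁅v⁆) (x≢y⇒x∉⁅y⁆ u≢v)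
...   | false = refl

_^ᵇ_ : ℤ → Bool → ℤ
z ^ᵇ b = if b then z else + 1

pow-card : ∀ {n} (z : ℤ) (W : Subset n) → z ^ ∣ W ∣ ≡ ∏ (λ u → z ^ᵇ lookup W u)
pow-card z []          = refl
pow-card z (true ∷ W)  = cong (z *_) (pow-card z W)
pow-card z (false ∷ W) = trans (pow-card z W) (sym (ℤP.*-identityˡ _))

-- The monomial x^|W| y^|N_H(W)| of a subset W of H = G[S] is a product of
-- local weights, one per vertex; sets are handled through their membership predicates.
module Weights {n} (G : Graph n) (x y : ℤ) where

  hasNeighbourIn : (Fin n → Bool) → Fin n → Bool
  hasNeighbourIn Y u = anyFin (λ w → Y w ∧ adj G w u)

  weight : (S Y : Fin n → Bool) → Fin n → ℤ
  weight S Y u = x ^ᵇ Y u * y ^ᵇ (S u ∧ not (Y u) ∧ hasNeighbourIn Y u)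

  term : Subset n → Subset n → ℤ
  term S W = x ^ ∣ W ∣ * y ^ ∣ openNbhd G S W ∣

  J-as-sum : J G ⊤ x y ≡ sumSubsets (term ⊤)
  J-as-sum = sumSubsets-cong (λ W → cong (λ b → if b then term ⊤ W else + 0)
               (trans (∧-identityʳ (W ⊆ᵇ ⊤)) (⊆ₚ-accept W (lookup ⊤) (λ u _ → lookup-⊤ u))))

  term-as-product : ∀ S W → term S W ≡ ∏ (weight (lookup S) (lookup W))
  term-as-product S W = begin
    x ^ ∣ W ∣ * y ^ ∣ openNbhd G S W ∣
      ≡⟨ cong₂ _*_ (pow-card x W) (pow-card y (openNbhd G S W)) ⟩
    ∏ (λ u → x ^ᵇ lookup W u) * ∏ (λ u → y ^ᵇ lookup (openNbhd G S W) u)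
      ≡⟨ ∑-distrib-+ (λ u → x ^ᵇ lookup W u) _ ⟨
    ∏ (λ u → x ^ᵇ lookup W u * y ^ᵇ lookup (openNbhd G S W) u)
      ≡⟨ sum-cong-≗ (λ u → cong (λ b → x ^ᵇ lookup W u * y ^ᵇ b) (lookup∘tabulate _ u)) ⟩
    ∏ (weight (lookup S) (lookup W))
      ∎
    where open ≡-Reasoning

  weight-local : ∀ {l} (u : Fin n) (k : Fin l) (S Y : Fin n → Bool) (Sⱼ Yⱼ : Fin l → Fin n → Bool) →
    (∀ j → j ≢ k → Sⱼ j u ≡ false) → (∀ j → j ≢ k → Yⱼ j u ≡ false) →
    Sⱼ k u ≡ S u → Yⱼ k u ≡ Y u → (∀ w → adj G w u ≡ true → Yⱼ k w ≡ Y w) →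
    ∏ (λ j → weight (Sⱼ j) (Yⱼ j) u) ≡ weight S Y u
  weight-local u k S Y Sⱼ Yⱼ notS notY atS atY nearY = begin
    ∏ (λ j → weight (Sⱼ j) (Yⱼ j) u)
      ≡⟨ ∏-single k _ outside-k ⟩
    weight′ (Sⱼ k u) (Yⱼ k u) (hasNeighbourIn (Yⱼ k) u)
      ≡⟨ cong₂ (λ s t → weight′ s t (hasNeighbourIn (Yⱼ k) u)) atS atY ⟩
    weight′ (S u) (Y u) (hasNeighbourIn (Yⱼ k) u)
      ≡⟨ cong (weight′ (S u) (Y u)) neighbours ⟩
    weight S Y u
      ∎
    where
    open ≡-Reasoning
    weight′ : Bool → Bool → Bool → ℤ
    weight′ s t a = x ^ᵇ t * y ^ᵇ (s ∧ not t ∧ a)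
    outside-k : ∀ j → j ≢ k → weight (Sⱼ j) (Yⱼ j) u ≡ + 1
    outside-k j j≢k rewrite notS j j≢k | notY j j≢k = refl
    neighbours : hasNeighbourIn (Yⱼ k) u ≡ hasNeighbourIn Y u
    neighbours = anyFin-cong pointwise
      where
      pointwise : ∀ w → Yⱼ k w ∧ adj G w u ≡ Y w ∧ adj G w u
      pointwise w with adj G w u in edge
      ... | true  = cong (_∧ true) (nearY w edge)
      ... | false = trans (∧-zeroʳ _) (sym (∧-zeroʳ _))

module CutVertex {n} (G : Graph n) (v : Fin n) (l′ : ℕ) (c : Fin n → Fin (suc l′))
                 (components : IsComponentLabelling G (minus ⊤ v) (suc l′) c) (x y : ℤ) where
  open Weights G x y

  D C : Fin (suc l′) → Subset n
  D = Dset G v c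
  C = Cset G v c

  inD : Fin (suc l′) → Fin n → Bool
  inD j u = avoiding v u ∧ c u == j

  farFromV : Fin n → Bool
  farFromV u = avoiding v u ∧ not (adj G v u)

  -- W ∩ c⁻¹(j), which is W ∩ V(D_j) when v ∉ W
  piece : Fin (suc l′) → Subset n → Subset n
  piece j = restrictTo (λ u → c u == j)

  lookup-minus : ∀ u → lookup (minus ⊤ v) u ≡ avoiding v u
  lookup-minus u = trans (lookup∘tabulate _ u) (cong₂ (λ a b → a ∧ not b) (lookup-⊤ u) (lookup-⁅⁆ v u))

  lookup-D : ∀ j u → lookup (D j) u ≡ inD j u
  lookup-D j u = trans (lookup∘tabulate _ u) (cong₂ _∧_ (lookup-minus u) (isYes≗does (c u ≟ j)))

  lookup-C : ∀ j u → lookup (C j) u ≡ inD j u ∨ u == v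
  lookup-C j u = trans (lookup∘tabulate _ u) (cong₂ _∨_ (lookup-D j u) (lookup-⁅⁆ v u))

  D-at-v : ∀ j → lookup (D j) v ≡ false
  D-at-v j = trans (lookup-D j v) (cong (λ b → not b ∧ c v == j) (==-refl v))

  C-at-v : ∀ j → lookup (C j) v ≡ true
  C-at-v j = trans (lookup-C j v) (trans (cong (inD j v ∨_) (==-refl v)) (∨-zeroʳ (inD j v)))

  D-off-v : ∀ j u → u ≢ v → lookup (D j) u ≡ (c u == j)
  D-off-v j u u≢v = trans (lookup-D j u) (cong (λ b → not b ∧ c u == j) (==-≢ u≢v))

  C-off-v : ∀ j u → u ≢ v → lookup (C j) u ≡ (c u == j)
  C-off-v j u u≢v =
    trans (lookup-C j u) (trans (cong₂ _∨_ (trans (sym (lookup-D j u)) (D-off-v j u u≢v)) (==-≢ u≢v)) (∨-identityʳ _))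

  P : Subset n → ℤ
  P W = ∏ (λ j → term (D j) (piece j W))

  sameComponent : ∀ w u → w ≢ v → u ≢ v → adj G w u ≡ true → c w ≡ c u
  sameComponent w u w≢v u≢v edge =
    Equivalence.from (proj₂ components w u (inG-v w w≢v) (inG-v u u≢v)) (step (inG-v w w≢v) edge (here (inG-v u u≢v)))
    where
    inG-v : ∀ z → z ≢ v → lookup (minus ⊤ v) z ≡ true
    inG-v z z≢v = trans (lookup-minus z) (cong not (==-≢ z≢v))

  record Pieces (S Yⱼ : Fin (suc l′) → Subset n) (Y : Subset n) : Set where
    field
      S-off  : ∀ j u → u ≢ v → lookup (S j) u ≡ (c u == j)
      Y-off  : ∀ j u → u ≢ v → lookup (Yⱼ j) u ≡ lookup Y u ∧ c u == j
      Y-at-v : ∀ j → lookup (Yⱼ j) v ≡ lookup Y v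

  -- Away from v the weights of the pieces multiply to the weight of Y: a vertex
  -- u ≠ v lies only in the piece c u, whose set agrees with Y on u and on its
  -- neighbours (which are v or lie in the same component).
  pieces-weight : ∀ {S Yⱼ Y} → Pieces S Yⱼ Y → ∀ u → u ≢ v →
    ∏ (λ j → weight (lookup (S j)) (lookup (Yⱼ j)) u) ≡ weight (lookup ⊤) (lookup Y) u
  pieces-weight {S} {Yⱼ} {Y} pieces u u≢v =
    weight-local u (c u) (lookup ⊤) (lookup Y) (lookup ∘ S) (lookup ∘ Yⱼ) notS notY atS atY nearY
    where
    open Pieces pieces
    notS : ∀ j → j ≢ c u → lookup (S j) u ≡ false
    notS j j≢cu = trans (S-off j u u≢v) (==-≢ (j≢cu ∘ sym))
    notY : ∀ j → j ≢ c u → lookup (Yⱼ j) u ≡ false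
    notY j j≢cu = trans (Y-off j u u≢v) (trans (cong (lookup Y u ∧_) (==-≢ (j≢cu ∘ sym))) (∧-zeroʳ _))
    inOwnPiece : ∀ w → w ≢ v → c w ≡ c u → lookup (Yⱼ (c u)) w ≡ lookup Y w
    inOwnPiece w w≢v same =
      trans (Y-off (c u) w w≢v) (trans (cong (λ i → lookup Y w ∧ i == c u) same)
            (trans (cong (lookup Y w ∧_) (==-refl (c u))) (∧-identityʳ _)))
    atS : lookup (S (c u)) u ≡ lookup ⊤ u
    atS = trans (S-off (c u) u u≢v) (trans (==-refl (c u)) (sym (lookup-⊤ u)))
    atY : lookup (Yⱼ (c u)) u ≡ lookup Y u
    atY = inOwnPiece u u≢v refl
    nearY : ∀ w → adj G w u ≡ true → lookup (Yⱼ (c u)) w ≡ lookup Y w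
    nearY w edge with w ≟ v
    ... | yes refl = Y-at-v (c u)
    ... | no w≢v   = inOwnPiece w w≢v (sameComponent w u w≢v u≢v edge)

  glue : ∀ {S Yⱼ Y} → Pieces S Yⱼ Y →
    ∀ k m → k * weight (lookup ⊤) (lookup Y) v ≡ m * ∏ (λ j → weight (lookup (S j)) (lookup (Yⱼ j)) v) →
    k * term ⊤ Y ≡ m * ∏ (λ j → term (S j) (Yⱼ j))
  glue {S} {Yⱼ} {Y} pieces k m at-v = begin
    k * term ⊤ Y
      ≡⟨ cong (k *_) (term-as-product ⊤ Y) ⟩
    k * ∏ (weight (lookup ⊤) (lookup Y))
      ≡⟨ ∏-agree-off v _ _ (λ u u≢v → sym (pieces-weight pieces u u≢v)) k m at-v ⟩
    m * ∏ (λ u → ∏ (λ j → weightⱼ j u))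
      ≡⟨ cong (m *_) (∑-comm weightⱼ) ⟨
    m * ∏ (λ j → ∏ (weightⱼ j))
      ≡⟨ cong (m *_) (sum-cong-≗ (λ j → sym (term-as-product (S j) (Yⱼ j)))) ⟩
    m * ∏ (λ j → term (S j) (Yⱼ j))
      ∎
    where
    open ≡-Reasoning
    weightⱼ : Fin (suc l′) → Fin n → ℤ
    weightⱼ j = weight (lookup (S j)) (lookup (Yⱼ j))

  glue-containing-v : ∀ W → lookup W v ≡ false →
    x ^ l′ * term ⊤ (insertAt v W) ≡ ∏ (λ j → term (C j) (insertAt v (piece j W)))
  glue-containing-v W v∉W =
    trans (glue pieces (x ^ l′) (+ 1) at-v) (ℤP.*-identityˡ _)
    where
    Y-off : ∀ j u → u ≢ v → lookup (insertAt v (piece j W)) u ≡ lookup (insertAt v W) u ∧ c u == j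
    Y-off j u u≢v = begin
      lookup (insertAt v (piece j W)) u  ≡⟨ lookup∘update′ u≢v (piece j W) inside ⟩
      lookup (piece j W) u               ≡⟨ lookup∘tabulate _ u ⟩
      lookup W u ∧ c u == j              ≡⟨ cong (_∧ c u == j) (lookup∘update′ u≢v W inside) ⟨
      lookup (insertAt v W) u ∧ c u == j ∎
      where open ≡-Reasoning
    Y-at-v : ∀ j → lookup (insertAt v (piece j W)) v ≡ lookup (insertAt v W) v
    Y-at-v j = trans (lookup∘update v (piece j W) inside) (sym (lookup∘update v W inside))
    pieces : Pieces C (λ j → insertAt v (piece j W)) (insertAt v W)
    pieces = record { S-off = C-off-v ; Y-off = Y-off ; Y-at-v = Y-at-v }
    pieceWeight : ∀ j → weight (lookup (C j)) (lookup (insertAt v (piece j W))) v ≡ x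
    pieceWeight j rewrite lookup∘update v (piece j W) inside | C-at-v j = ℤP.*-identityʳ x
    at-v : x ^ l′ * weight (lookup ⊤) (lookup (insertAt v W)) v
           ≡ + 1 * ∏ (λ j → weight (lookup (C j)) (lookup (insertAt v (piece j W))) v)
    at-v rewrite lookup∘update v W inside | lookup-⊤ v | ∏-const x _ pieceWeight = arith x (x ^ l′)
      where arith : ∀ x z → z * (x * + 1) ≡ + 1 * (x * z)
            arith = solve-∀

  glue-avoiding-v : ∀ W → lookup W v ≡ false →
    term ⊤ W ≡ y ^ᵇ hasNeighbourIn (lookup W) v * P W
  glue-avoiding-v W v∉W =
    trans (sym (ℤP.*-identityˡ _)) (glue pieces (+ 1) (y ^ᵇ nb) at-v)
    where
    nb : Bool
    nb = hasNeighbourIn (lookup W) v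
    Y-off : ∀ j u → u ≢ v → lookup (piece j W) u ≡ lookup W u ∧ c u == j
    Y-off j u _ = lookup∘tabulate _ u
    Y-at-v : ∀ j → lookup (piece j W) v ≡ lookup W v
    Y-at-v j = trans (lookup∘tabulate _ v) (trans (cong (_∧ c v == j) v∉W) (sym v∉W))
    pieces : Pieces D (λ j → piece j W) W
    pieces = record { S-off = D-off-v ; Y-off = Y-off ; Y-at-v = Y-at-v }
    pieceWeight : ∀ j → weight (lookup (D j)) (lookup (piece j W)) v ≡ + 1
    pieceWeight j rewrite Y-at-v j | v∉W | D-at-v j = refl
    at-v : + 1 * weight (lookup ⊤) (lookup W) v ≡ y ^ᵇ nb * ∏ (λ j → weight (lookup (D j)) (lookup (piece j W)) v)
    at-v rewrite v∉W | lookup-⊤ v | ∏-const (+ 1) _ pieceWeight | ℤP.^-zeroˡ (suc l′) = arith (y ^ᵇ nb)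
      where arith : ∀ z → + 1 * (+ 1 * z) ≡ z * + 1
            arith = solve-∀

  J-containing-v : ∀ j → Jc G (C j) (λ W → lookup W v) x y ≡ sumWithin (inD j) (term (C j) ∘ insertAt v)
  J-containing-v j = begin
    Jc G (C j) (λ W → lookup W v) x y
      ≡⟨ sumSubsets-cong membershipFirst ⟩
    sumSubsets (λ W → if lookup W v then inC W else + 0)
      ≡⟨ sum-containing v inC ⟩
    sumSubsets (λ W → if lookup W v then + 0 else inC (insertAt v W))
      ≡⟨ sumSubsets-cong asWithin ⟩
    sumWithin (inD j) (term (C j) ∘ insertAt v)
      ∎
    where
    open ≡-Reasoning
    inC : Subset n → ℤ
    inC W = if W ⊆ᵇ C j then term (C j) W else + 0
    membershipFirst : ∀ W → (if (W ⊆ᵇ C j) ∧ lookup W v then term (C j) W else + 0)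
                            ≡ (if lookup W v then inC W else + 0)
    membershipFirst W with lookup W v
    ... | true  rewrite ∧-identityʳ (W ⊆ᵇ C j) = refl
    ... | false rewrite ∧-zeroʳ (W ⊆ᵇ C j) = refl
    insertedInside : ∀ W → lookup W v ≡ false → insertAt v W ⊆ᵇ C j ≡ W ⊆ₚ inD j
    insertedInside W v∉W = allFin-cong pointwise
      where
      pointwise : ∀ u → not (lookup (insertAt v W) u) ∨ lookup (C j) u ≡ not (lookup W u) ∨ inD j u
      pointwise u with u ≟ v
      ... | yes refl rewrite lookup∘update v W inside | v∉W | C-at-v j = refl
      ... | no u≢v   rewrite lookup∘update′ u≢v W inside | C-off-v j u u≢v = refl
    asWithin : ∀ W → (if lookup W v then + 0 else inC (insertAt v W))
                     ≡ (if W ⊆ₚ inD j then term (C j) (insertAt v W) else + 0)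
    asWithin W with lookup W v in v∈W?
    ... | true  rewrite ⊆ₚ-reject W (inD j) v v∈W? (cong (λ b → not b ∧ c v == j) (==-refl v)) = refl
    ... | false rewrite insertedInside W v∈W? = refl

  J-D : ∀ j → J G (D j) x y ≡ sumWithin (inD j) (term (D j))
  J-D j = sumSubsets-cong (λ W → cong (λ b → if b then term (D j) W else + 0)
                              (trans (∧-identityʳ (W ⊆ᵇ D j)) (⊆ₚ-cong W (λ u _ → lookup-D j u))))

  far-no-neighbour : ∀ W → W ⊆ₚ farFromV ≡ true → hasNeighbourIn (lookup W) v ≡ false
  far-no-neighbour W far = anyFin-false _ notAdjacent
    where
    notAdjacent : ∀ w → lookup W w ∧ adj G w v ≡ false
    notAdjacent w with lookup W w in w∈W
    ... | false = refl
    ... | true  = trans (Graph.sym G w v) (not-injective (∧-trueʳ {avoiding v w} (⊆ₚ-elim W farFromV far w w∈W)))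

  farInD : Fin (suc l′) → Fin n → Bool
  farInD j u = farFromV u ∧ c u == j

  far-condition : ∀ j W u →
    (not (lookup W u) ∨ lookup (C j) u) ∧ not (lookup (closedNbhd G (C j) v) u ∧ lookup W u)
      ≡ not (lookup W u) ∨ farInD j u
  far-condition j W u rewrite lookup∘tabulate (λ u → lookup (C j) u ∧ (lookup ⁅ v ⁆ u ∨ adj G v u)) u
                            | lookup-⁅⁆ v u
                            with lookup W u | u ≟ v
  ... | false | _        = cong not (∧-zeroʳ _)
  ... | true  | yes refl rewrite C-at-v j = refl
  ... | true  | no u≢v   rewrite C-off-v j u u≢v with c u == j | adj G v u
  ...   | true  | true  = refl
  ...   | true  | false = refl
  ...   | false | true  = refl
  ...   | false | false = refl

  far-neighbourhoods : ∀ j W → W ⊆ₚ farFromV ≡ true → openNbhd G (C j) W ≡ openNbhd G (D j) W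
  far-neighbourhoods j W far = tabulate-cong agree
    where
    agree : ∀ u → lookup (C j) u ∧ not (lookup W u) ∧ hasNeighbourIn (lookup W) u
                  ≡ lookup (D j) u ∧ not (lookup W u) ∧ hasNeighbourIn (lookup W) u
    agree u with u ≟ v
    ... | yes refl rewrite C-at-v j | D-at-v j | far-no-neighbour W far = ∧-zeroʳ _
    ... | no u≢v   rewrite C-off-v j u u≢v | D-off-v j u u≢v = refl

  J-far : ∀ j → Jc G (C j) (disjointᵇ (closedNbhd G (C j) v)) x y ≡ sumWithin (farInD j) (term (D j))
  J-far j = sumSubsets-cong pointwise
    where
    N : Subset n
    N = closedNbhd G (C j) v
    pointwise : ∀ W → (if (W ⊆ᵇ C j) ∧ disjointᵇ N W then term (C j) W else + 0)
                      ≡ (if W ⊆ₚ farInD j then term (D j) W else + 0)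
    pointwise W rewrite allFin-∧ (λ u → not (lookup W u) ∨ lookup (C j) u) (λ u → not (lookup N u ∧ lookup W u))
                      | allFin-cong (far-condition j W)
                      with W ⊆ₚ farInD j in sub
    ... | false = refl
    ... | true  = cong (λ S → x ^ ∣ W ∣ * y ^ ∣ S ∣) (far-neighbourhoods j W (⊆ₚ-weaken W (λ u → ∧-trueˡ) sub))

  far-iff-no-neighbour : ∀ W → lookup W v ≡ false → W ⊆ₚ farFromV ≡ not (hasNeighbourIn (lookup W) v)
  far-iff-no-neighbour W v∉W = trans (allFin-cong pointwise) (allFin-not (λ u → lookup W u ∧ adj G u v))
    where
    pointwise : ∀ u → not (lookup W u) ∨ farFromV u ≡ not (lookup W u ∧ adj G u v)
    pointwise u with lookup W u in u∈W | u ≟ v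
    ... | false | _        = refl
    ... | true  | yes refl = contradiction (trans (sym u∈W) v∉W) λ ()
    ... | true  | no _     = cong not (Graph.sym G v u)

  -- The terms of sets W ∌ v, split by y^[v ∈ N(W)] = y + (1 - y)[v ∉ N(W)].
  avoiding-term : ∀ W →
    (if W ⊆ₚ avoiding v then term ⊤ W else + 0)
      ≡ y * (if W ⊆ₚ avoiding v then P W else + 0) + (+ 1 - y) * (if W ⊆ₚ farFromV then P W else + 0)
  avoiding-term W rewrite ⊆ₚ-avoiding v W with lookup W v in v∈W?
  ... | true  rewrite ⊆ₚ-reject W farFromV v v∈W? (cong (λ b → not b ∧ not (adj G v v)) (==-refl v)) = arith y
    where arith : ∀ y → + 0 ≡ y * + 0 + (+ 1 - y) * + 0
          arith = solve-∀
  ... | false rewrite far-iff-no-neighbour W v∈W? | glue-avoiding-v W v∈W? = split (hasNeighbourIn (lookup W) v) (P W)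
    where
    split : ∀ b Q → y ^ᵇ b * Q ≡ y * Q + (+ 1 - y) * (if not b then Q else + 0)
    split true  Q = arith y Q
      where arith : ∀ y Q → y * Q ≡ y * Q + (+ 1 - y) * + 0
            arith = solve-∀
    split false Q = arith y Q
      where arith : ∀ y Q → + 1 * Q ≡ y * Q + (+ 1 - y) * Q
            arith = solve-∀

  containing-part : x ^ l′ * sumWithin (avoiding v) (term ⊤ ∘ insertAt v)
                    ≡ ∏ (λ j → Jc G (C j) (λ W → lookup W v) x y)
  containing-part = begin
    x ^ l′ * sumWithin (avoiding v) (term ⊤ ∘ insertAt v)
      ≡⟨ sumWithin-scale (avoiding v) (x ^ l′) _ _ (λ W sub → glue-containing-v W (avoiding⇒∉ v W sub)) ⟩
    sumWithin (avoiding v) (λ W → ∏ (λ j → term (C j) (insertAt v (piece j W))))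
      ≡⟨ sumWithin-factorise (avoiding v) c (λ j → term (C j) ∘ insertAt v) ⟩
    ∏ (λ j → sumWithin (inD j) (term (C j) ∘ insertAt v))
      ≡⟨ sum-cong-≗ (λ j → sym (J-containing-v j)) ⟩
    ∏ (λ j → Jc G (C j) (λ W → lookup W v) x y)
      ∎
    where open ≡-Reasoning

  avoiding-part : sumWithin (avoiding v) (term ⊤)
                  ≡ y * ∏ (λ j → J G (D j) x y)
                    + (+ 1 - y) * ∏ (λ j → Jc G (C j) (disjointᵇ (closedNbhd G (C j) v)) x y)
  avoiding-part = begin
    sumWithin (avoiding v) (term ⊤)
      ≡⟨ sumSubsets-cong avoiding-term ⟩
    sumSubsets (λ W → y * withinAvoiding W + (+ 1 - y) * withinFar W)
      ≡⟨ sumℤ-+ (λ W → y * withinAvoiding W) _ (allSubsets n) ⟩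
    sumSubsets (λ W → y * withinAvoiding W) + sumSubsets (λ W → (+ 1 - y) * withinFar W)
      ≡⟨ cong₂ _+_ (sumℤ-* y withinAvoiding (allSubsets n)) (sumℤ-* (+ 1 - y) withinFar (allSubsets n)) ⟨
    y * sumWithin (avoiding v) P + (+ 1 - y) * sumWithin farFromV P
      ≡⟨ cong₂ (λ a b → y * a + (+ 1 - y) * b) (sumWithin-factorise (avoiding v) c (λ j → term (D j)))
                                               (sumWithin-factorise farFromV c (λ j → term (D j))) ⟩
    y * ∏ (λ j → sumWithin (inD j) (term (D j)))
      + (+ 1 - y) * ∏ (λ j → sumWithin (farInD j) (term (D j)))
      ≡⟨ cong₂ (λ a b → y * a + (+ 1 - y) * b) (sum-cong-≗ (λ j → sym (J-D j)))
                                               (sum-cong-≗ (λ j → sym (J-far j))) ⟩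
    y * ∏ (λ j → J G (D j) x y) + (+ 1 - y) * ∏ (λ j → Jc G (C j) (disjointᵇ (closedNbhd G (C j) v)) x y)
      ∎
    where
    open ≡-Reasoning
    withinAvoiding withinFar : Subset n → ℤ
    withinAvoiding W = if W ⊆ₚ avoiding v then P W else + 0
    withinFar W = if W ⊆ₚ farFromV then P W else + 0

-- Lemma 7.
lemma7 : ∀ {n} (G : Graph n) (v : Fin n) → IsCutVertex G v →
    ∀ (l : ℕ) (c : Fin n → Fin l) → IsComponentLabelling G (minus ⊤ v) l c →
    ∀ (x y : ℤ) →
      x ^ (l ∸ 1) * J G ⊤ x y
        ≡ prodFin (λ j → Jc G (Cset G v c j) (λ W → lookup W v) x y)
          + x ^ (l ∸ 1) * (y * prodFin (λ j → J G (Dset G v c j) x y)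
              + (+ 1 - y) * prodFin (λ j → Jc G (Cset G v c j)
                   (disjointᵇ (closedNbhd G (Cset G v c j) v)) x y))
lemma7 G v _ zero c _ x y with c v
... | ()
lemma7 G v _ (suc l′) c components x y = begin
  x ^ l′ * J G ⊤ x y
    ≡⟨ cong (x ^ l′ *_) (trans J-as-sum (sum-split-at v (term ⊤))) ⟩
  x ^ l′ * (sumWithin (avoiding v) (term ⊤ ∘ insertAt v) + sumWithin (avoiding v) (term ⊤))
    ≡⟨ ℤP.*-distribˡ-+ (x ^ l′) _ _ ⟩
  x ^ l′ * sumWithin (avoiding v) (term ⊤ ∘ insertAt v) + x ^ l′ * sumWithin (avoiding v) (term ⊤)
    ≡⟨ cong₂ (λ a b → a + x ^ l′ * b) containing-part avoiding-part ⟩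
  ∏ J-C∋v + x ^ l′ * (y * ∏ J-Dⱼ + (+ 1 - y) * ∏ J-C-far)
    ≡⟨ cong₂ (λ a r → a + x ^ l′ * r) (prodFin≡∏ J-C∋v)
             (cong₂ (λ b d → y * b + (+ 1 - y) * d) (prodFin≡∏ J-Dⱼ) (prodFin≡∏ J-C-far)) ⟨
  prodFin J-C∋v + x ^ l′ * (y * prodFin J-Dⱼ + (+ 1 - y) * prodFin J-C-far)
    ∎
  where
  open ≡-Reasoning
  open Weights G x y
  open CutVertex G v l′ c components x y
  J-C∋v J-Dⱼ J-C-far : Fin (suc l′) → ℤ
  J-C∋v j   = Jc G (C j) (λ W → lookup W v) x y
  J-Dⱼ j    = J G (D j) x y
  J-C-far j = Jc G (C j) (disjointᵇ (closedNbhd G (C j) v)) x y
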